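{- Let $k\geq 2$ and $n\geq 1$ be integers, let $t_1,\dots,t_k$ be indeterminates, and work in the field $\mathbb{C}(t_1,\dots,t_k)$ of rational functions. Set $t_0=1$ and let $i=\sqrt{ -1}$. Let $Q_{k,n}=(q_{rs})_{1\le r,s\le n}$ be the $n\times n$ matrix with $$q_{rs}=\begin{cases} i^{|r-s|}\,\dfrac{t_{r-s+1}}{t_2^{\,r-s}} & \text{if } -1\leq r-s<k,\\[2mm] 0 & \text{otherwise.}\end{cases}$$ (Thus the superdiagonal entries are $i t_2$, the diagonal entries are $t_1$, the subdiagonal entries are $i$, and the entries with $r-s=d$, $2\le d\le k-1$, are $i^{d} t_{d+1}/t_2^{d}$.) Then $$\det(Q_{k,n})=F_{k,n+1}(t).$$
   Context: The generalized Fibonacci polynomials $F_{k,n}(t)$, $t=(t_1,\dots,t_k)$, are defined by $F_{k,n}(t)=0$ for $n<1$, $F_{k,1}(t)=1$, $F_{k,2}(t)=t_1$, and $F_{k,n+1}(t)=t_1F_{k,n}(t)+t_2F_{k,n-1}(t)+\cdots+t_kF_{k,n-k+1}(t)$ for $n\ge 1$. -}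

module Defs where

open import Level using (Level)
open import Algebra.Bundles using (CommutativeRing)
open import Data.Nat as ℕ using (ℕ; zero; suc; _∸_; _<?_; _≟_)
open import Data.Fin using (Fin; zero; suc; toℕ; fromℕ<; punchIn)
open import Data.List using (List; []; _∷_)
open import Relation.Nullary using (yes; no)

module FibDet {c ℓ : Level} (R : CommutativeRing c ℓ) where
  open CommutativeRing R using (Carrier; _+_; _*_; -_; 0#; 1#)

  pow : Carrier → ℕ → Carrier
  pow x zero    = 1#
  pow x (suc m) = x * pow x m

  sign : ℕ → Carrier
  sign zero    = 1#
  sign (suc m) = - sign m

  sumFin : (m : ℕ) → (Fin m → Carrier) → Carrier
  sumFin zero    f = 0#
  sumFin (suc m) f = f zero + sumFin m (λ j → f (suc j))

  det : (m : ℕ) → (Fin m → Fin m → Carrier) → Carrier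
  det zero    M = 1#
  det (suc m) M =
    sumFin (suc m) (λ r → sign (toℕ r) * (M r zero *
      det m (λ a b → M (punchIn r a) (suc b))))

  -- Generalized Fibonacci polynomials F_{k,n}(t); t j stands for t_{j+1}.
  -- index : j-th element of a list, 0 if out of range
  index : List Carrier → ℕ → Carrier
  index []       _       = 0#
  index (x ∷ xs) zero    = x
  index (x ∷ xs) (suc j) = index xs j

  -- FibList k t n = [F_n, F_{n-1}, ..., F_0]
  FibList : (k : ℕ) → (Fin k → Carrier) → ℕ → List Carrier
  FibList k t zero    = 0# ∷ []
  FibList k t (suc zero) = 1# ∷ 0# ∷ []
  FibList k t (suc (suc n)) =
    let prev = FibList k t (suc n)
    -- F_{n+2} = Σ_{j=1..k} t_j F_{n+2-j}; F_{n+2-j} is entry j-1 of prev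
    in sumFin k (λ j → t j * index prev (toℕ j)) ∷ prev

  -- F_{k,n}(t) for n ≥ 0 (F_{k,0} = 0; negative indices are handled as 0 above)
  Fib : (k : ℕ) → (Fin k → Carrier) → ℕ → Carrier
  Fib k t n = index (FibList k t n) 0

  -- The matrix Q_{k,n}; indices r s : Fin n are 0-based (r-s unchanged).
  -- i : a square root of -1; u : the inverse of t₂; t₂ : the value t_2.
  -- entry: r - s = -1  ↦ i·t₂ ; r - s = d with 0 ≤ d < k ↦ i^d · t_{d+1} · u^d ; else 0
  Q : (k : ℕ) → (Fin k → Carrier) → (i t₂ u : Carrier) →
      (n : ℕ) → Fin n → Fin n → Carrier
  Q k t i t₂ u n r s with suc (toℕ r) ≟ toℕ s
  ... | yes _ = i * t₂
  ... | no _ with toℕ s ℕ.≤? toℕ r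
  ...   | no _ = 0#
  ...   | yes _ with toℕ r ∸ toℕ s <? k
  ...     | yes d<k = pow i (toℕ r ∸ toℕ s) * (t (fromℕ< d<k) * pow u (toℕ r ∸ toℕ s))
  ...     | no _ = 0#

-- Q is a lower Hessenberg Toeplitz matrix: constant superdiagonal c = i t₂ and a
-- constant a_d on the d-th subdiagonal.  Expanding D_m = det Q_{k,m} along the first
-- column, the minor of row r is block triangular with r copies of c on its diagonal,
-- so D_{m+1} = Σ_{j ≤ m} (-1)ʲ aⱼ cʲ D_{m-j}.  With aⱼ = iʲ t_{j+1} t₂⁻ʲ and i² = -1 the
-- coefficient (-1)ʲ aⱼ cʲ is exactly t_{j+1}, which is the Fibonacci recurrence;
-- both sequences start at 1, so they agree.
module Submission where

open import Defs
open import Level using (Level)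
open import Algebra.Bundles using (CommutativeRing)
open import Data.Nat using (ℕ; suc; _≤_)
open import Data.Fin using (Fin; fromℕ<)

open import Data.Nat as ℕ using (zero; _∸_; _<_; _<?_; _≟_; _≤?_; z≤n; s≤s; s≤s⁻¹)
import Data.Nat.Properties as ℕₚ
open import Data.Nat.Properties using (m∸n≤m; +-∸-assoc; ≤⇒≯; m≤n⇒m≤1+n)
open import Data.Nat.Induction using (<-rec)
open import Data.Fin as Fin using (zero; suc; toℕ; punchIn; punchOut)
open import Data.Fin.Properties using (toℕ<n; fromℕ<-cong; fromℕ<-toℕ; punchIn-punchOut)
open import Relation.Nullary using (yes; no; ¬_)
open import Relation.Nullary.Negation using (contradiction)
open import Relation.Binary.PropositionalEquality as ≡ using (_≡_; _≢_)
import Relation.Binary.Reasoning.Setoid as SetoidReasoning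

module Sums {a ℓ : Level} (R : CommutativeRing a ℓ) where
  open CommutativeRing R hiding (zero)
  open FibDet R using (sumFin)
  open SetoidReasoning setoid

  sumFin-cong : ∀ n (f g : Fin n → Carrier) → (∀ x → f x ≈ g x) → sumFin n f ≈ sumFin n g
  sumFin-cong zero    f g f≈g = refl
  sumFin-cong (suc n) f g f≈g =
    +-cong (f≈g zero)
           (sumFin-cong n (λ x → f (suc x)) (λ x → g (suc x)) (λ x → f≈g (suc x)))

  sumFin-zero : ∀ n (f : Fin n → Carrier) → (∀ x → f x ≈ 0#) → sumFin n f ≈ 0#
  sumFin-zero zero    f f≈0 = refl
  sumFin-zero (suc n) f f≈0 =
    trans (+-cong (f≈0 zero) (sumFin-zero n (λ x → f (suc x)) (λ x → f≈0 (suc x))))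
          (+-identityˡ 0#)

  sumBelow : ℕ → (ℕ → Carrier) → Carrier
  sumBelow n g = sumFin n (λ x → g (toℕ x))

  sumBelow-cong : ∀ n (g h : ℕ → Carrier) → (∀ j → j < n → g j ≈ h j) →
                  sumBelow n g ≈ sumBelow n h
  sumBelow-cong n g h g≈h = sumFin-cong n _ _ (λ x → g≈h (toℕ x) (toℕ<n x))

  sumBelow-extend : ∀ n p (g : ℕ → Carrier) → (∀ j → n ≤ j → g j ≈ 0#) →
                    sumBelow (n ℕ.+ p) g ≈ sumBelow n g
  sumBelow-extend zero    p g g≈0 = sumFin-zero p _ (λ x → g≈0 (toℕ x) z≤n)
  sumBelow-extend (suc n) p g g≈0 =
    +-congˡ (sumBelow-extend n p (λ j → g (suc j)) (λ j n≤j → g≈0 (suc j) (s≤s n≤j)))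

  sumBelow-support : ∀ m n (g : ℕ → Carrier) →
                     (∀ j → m ≤ j → g j ≈ 0#) → (∀ j → n ≤ j → g j ≈ 0#) →
                     sumBelow m g ≈ sumBelow n g
  sumBelow-support m n g g≈0-from-m g≈0-from-n = begin
    sumBelow m g         ≈⟨ sumBelow-extend m n g g≈0-from-m ⟨
    sumBelow (m ℕ.+ n) g ≡⟨ ≡.cong (λ l → sumBelow l g) (ℕₚ.+-comm m n) ⟩
    sumBelow (n ℕ.+ m) g ≈⟨ sumBelow-extend n m g g≈0-from-n ⟩
    sumBelow n g         ∎

module Powers {a ℓ : Level} (R : CommutativeRing a ℓ) where
  open CommutativeRing R hiding (zero)
  open FibDet R using (pow; sign)
  open import Algebra.Properties.CommutativeSemigroup *-commutativeSemigroup
    using (interchange; x∙yz≈y∙xz)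
  open import Algebra.Properties.Ring ring
    using (-1*x≈-x; -‿distribˡ-*; -‿distribʳ-*; -‿involutive)
  open SetoidReasoning setoid

  pow-congˡ : ∀ {x y} j → x ≈ y → pow x j ≈ pow y j
  pow-congˡ zero    x≈y = refl
  pow-congˡ (suc j) x≈y = *-cong x≈y (pow-congˡ j x≈y)

  pow-distrib-* : ∀ x y j → pow (x * y) j ≈ pow x j * pow y j
  pow-distrib-* x y zero    = sym (*-identityˡ 1#)
  pow-distrib-* x y (suc j) = trans (*-congˡ (pow-distrib-* x y j)) (interchange x y _ _)

  sign*pow-1 : ∀ j → sign j * pow (- 1#) j ≈ 1#
  sign*pow-1 zero    = *-identityˡ 1#
  sign*pow-1 (suc j) = begin
    - sign j * (- 1# * pow (- 1#) j) ≈⟨ *-congˡ (-1*x≈-x _) ⟩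
    - sign j * - pow (- 1#) j        ≈⟨ -‿distribˡ-* _ _ ⟨
    - (sign j * - pow (- 1#) j)      ≈⟨ -‿cong (-‿distribʳ-* _ _) ⟨
    - - (sign j * pow (- 1#) j)      ≈⟨ -‿involutive _ ⟩
    sign j * pow (- 1#) j            ≈⟨ sign*pow-1 j ⟩
    1#                               ∎

  sign-scaling : ∀ {i t₂ u} → i * i ≈ - 1# → t₂ * u ≈ 1# →
                 ∀ x j → sign j * ((pow i j * (x * pow u j)) * pow (i * t₂) j) ≈ x
  sign-scaling {i} {t₂} {u} i²≈-1 t₂u≈1 x j = begin
    sign j * ((pow i j * (x * pow u j)) * pow (i * t₂) j)
      ≈⟨ *-congˡ (*-congʳ (x∙yz≈y∙xz _ _ _)) ⟩
    sign j * ((x * (pow i j * pow u j)) * pow (i * t₂) j)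
      ≈⟨ *-congˡ (*-assoc _ _ _) ⟩
    sign j * (x * ((pow i j * pow u j) * pow (i * t₂) j))
      ≈⟨ *-congˡ (*-congˡ (*-congʳ (pow-distrib-* i u j))) ⟨
    sign j * (x * (pow (i * u) j * pow (i * t₂) j))
      ≈⟨ *-congˡ (*-congˡ (pow-distrib-* (i * u) (i * t₂) j)) ⟨
    sign j * (x * pow ((i * u) * (i * t₂)) j)
      ≈⟨ *-congˡ (*-congˡ (pow-congˡ j iu-it₂≈-1)) ⟩
    sign j * (x * pow (- 1#) j)
      ≈⟨ x∙yz≈y∙xz _ _ _ ⟩
    x * (sign j * pow (- 1#) j)
      ≈⟨ *-congˡ (sign*pow-1 j) ⟩
    x * 1#
      ≈⟨ *-identityʳ x ⟩
    x ∎
    where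
    iu-it₂≈-1 : (i * u) * (i * t₂) ≈ - 1#
    iu-it₂≈-1 = begin
      (i * u) * (i * t₂) ≈⟨ interchange i u i t₂ ⟩
      (i * i) * (u * t₂) ≈⟨ *-cong i²≈-1 (trans (*-comm u t₂) t₂u≈1) ⟩
      - 1# * 1#          ≈⟨ *-identityʳ _ ⟩
      - 1#               ∎

module Determinants {a ℓ : Level} (R : CommutativeRing a ℓ) where
  open CommutativeRing R hiding (zero)
  open FibDet R using (sumFin; sign; det)
  open Sums R
  open SetoidReasoning setoid

  Matrix : ℕ → Set a
  Matrix m = Fin m → Fin m → Carrier

  minor : ∀ {m} → Matrix (suc m) → Fin (suc m) → Matrix m
  minor M r x y = M (punchIn r x) (suc y)

  cofactor : ∀ {m} → Matrix (suc m) → Fin (suc m) → Carrier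
  cofactor {m} M r = sign (toℕ r) * (M r zero * det m (minor M r))

  det-cong : ∀ m (M N : Matrix m) → (∀ r s → M r s ≈ N r s) → det m M ≈ det m N
  det-cong zero    M N M≈N = refl
  det-cong (suc m) M N M≈N = sumFin-cong (suc m) (cofactor M) (cofactor N) λ r →
    *-congˡ (*-cong (M≈N r zero)
                    (det-cong m (minor M r) (minor N r) (λ x y → M≈N (punchIn r x) (suc y))))

  det-zero-row : ∀ m (M : Matrix m) (r₀ : Fin m) → (∀ s → M r₀ s ≈ 0#) → det m M ≈ 0#
  det-zero-row (suc m) M r₀ row≈0 = sumFin-zero (suc m) (cofactor M) cofactor≈0
    where
    cofactor≈0 : ∀ r → cofactor M r ≈ 0#
    cofactor≈0 r with r Fin.≟ r₀
    ... | yes ≡.refl = trans (*-congˡ (trans (*-congʳ (row≈0 zero)) (zeroˡ _))) (zeroʳ _)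
    ... | no r≢r₀ = trans (*-congˡ (trans (*-congˡ minor≈0) (zeroʳ _))) (zeroʳ _)
      where
      -- in the minor of row r, the zero row r₀ sits at position punchOut r≢r₀
      minor≈0 : det m (minor M r) ≈ 0#
      minor≈0 = det-zero-row m (minor M r) (punchOut r≢r₀) λ s →
        ≡.subst (λ x → M x (suc s) ≈ 0#) (≡.sym (punchIn-punchOut r≢r₀)) (row≈0 (suc s))

  det-first-row : ∀ m (M : Matrix (suc m)) → (∀ s → M zero (suc s) ≈ 0#) →
                  det (suc m) M ≈ M zero zero * det m (minor M zero)
  det-first-row zero    M _ = trans (+-identityʳ _) (*-identityˡ _)
  det-first-row (suc m) M row₀≈0 = begin
    1# * leading + sumFin (suc m) lower
      ≈⟨ +-cong (*-identityˡ leading) (sumFin-zero (suc m) lower lower≈0) ⟩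
    leading + 0#
      ≈⟨ +-identityʳ leading ⟩
    leading ∎
    where
    leading = M zero zero * det (suc m) (minor M zero)
    lower : Fin (suc m) → Carrier
    lower j = cofactor M (suc j)
    lower≈0 : ∀ j → lower j ≈ 0#
    lower≈0 j = trans (*-congˡ (trans (*-congˡ minor≈0) (zeroʳ _))) (zeroʳ _)
      where
      minor≈0 : det (suc m) (minor M (suc j)) ≈ 0#
      minor≈0 = det-zero-row (suc m) (minor M (suc j)) zero row₀≈0

module HessenbergToeplitz {a ℓ : Level} (R : CommutativeRing a ℓ)
  (super : CommutativeRing.Carrier R) (sub : ℕ → CommutativeRing.Carrier R) where
  open CommutativeRing R hiding (zero)
  open FibDet R using (pow; sign; det)
  open Sums R
  open Determinants R
  open SetoidReasoning setoid

  -- sub d lies on the d-th subdiagonal (d = 0 is the diagonal)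
  entry : ℕ → ℕ → Carrier
  entry zero    zero          = sub 0
  entry zero    (suc zero)    = super
  entry zero    (suc (suc _)) = 0#
  entry (suc r) zero          = sub (suc r)
  entry (suc r) (suc s)       = entry r s

  entry-super : ∀ r s → suc r ≡ s → entry r s ≡ super
  entry-super zero    .1                 ≡.refl = ≡.refl
  entry-super (suc r) .(suc (suc r)) ≡.refl = entry-super r (suc r) ≡.refl

  entry-above : ∀ r s → suc r ≢ s → ¬ s ≤ r → entry r s ≡ 0#
  entry-above zero    zero          _      s≰r = contradiction z≤n s≰r
  entry-above zero    (suc zero)    1+r≢s _   = contradiction ≡.refl 1+r≢s
  entry-above zero    (suc (suc s)) _      _   = ≡.refl
  entry-above (suc r) zero          _      s≰r = contradiction z≤n s≰r
  entry-above (suc r) (suc s)       1+r≢s s≰r =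
    entry-above r s (λ eq → 1+r≢s (≡.cong suc eq)) (λ s≤r → s≰r (s≤s s≤r))

  entry-below : ∀ r s → s ≤ r → entry r s ≡ sub (r ∸ s)
  entry-below zero    zero    _         = ≡.refl
  entry-below (suc r) zero    _         = ≡.refl
  entry-below (suc r) (suc s) (s≤s s≤r) = entry-below r s s≤r

  entry-first-column : ∀ r → entry r 0 ≡ sub r
  entry-first-column r = entry-below r 0 z≤n

  H : ∀ m → Matrix m
  H m r s = entry (toℕ r) (toℕ s)

  D : ℕ → Carrier
  D m = det m (H m)

  -- the first r rows of this minor are lower triangular with super on the diagonal
  first-column-minor : ∀ m (r : Fin (suc m)) →
                       det m (minor (H (suc m)) r) ≈ pow super (toℕ r) * D (m ∸ toℕ r)
  first-column-minor m       zero    = sym (*-identityˡ _)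
  first-column-minor (suc m) (suc r) = begin
    det (suc m) (minor (H (suc (suc m))) (suc r))
      ≈⟨ det-first-row m (minor (H (suc (suc m))) (suc r)) (λ _ → refl) ⟩
    super * det m (minor (H (suc m)) r)
      ≈⟨ *-congˡ (first-column-minor m r) ⟩
    super * (pow super (toℕ r) * D (m ∸ toℕ r))
      ≈⟨ *-assoc _ _ _ ⟨
    pow super (suc (toℕ r)) * D (m ∸ toℕ r) ∎

  D-suc : ∀ m →
          D (suc m) ≈ sumBelow (suc m) (λ j → (sign j * (sub j * pow super j)) * D (m ∸ j))
  D-suc m = sumFin-cong (suc m) (cofactor (H (suc m))) (λ r → term (toℕ r)) λ r →
    let j = toℕ r in begin
    sign j * (entry j 0 * det m (minor (H (suc m)) r))
      ≈⟨ *-congˡ (*-cong (reflexive (entry-first-column j)) (first-column-minor m r)) ⟩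
    sign j * (sub j * (pow super j * D (m ∸ j)))
      ≈⟨ *-congˡ (*-assoc _ _ _) ⟨
    sign j * ((sub j * pow super j) * D (m ∸ j))
      ≈⟨ *-assoc _ _ _ ⟨
    term j ∎
    where
    term : ℕ → Carrier
    term j = (sign j * (sub j * pow super j)) * D (m ∸ j)

module LinearRecurrence {a ℓ : Level} (R : CommutativeRing a ℓ)
  (coeff : ℕ → CommutativeRing.Carrier R) where
  open CommutativeRing R hiding (zero)
  open Sums R
  open SetoidReasoning setoid

  Satisfies : (ℕ → Carrier) → Set ℓ
  Satisfies X = ∀ m → X (suc m) ≈ sumBelow (suc m) (λ j → coeff j * X (m ∸ j))

  solution-unique : ∀ {X Y : ℕ → Carrier} → Satisfies X → Satisfies Y → X 0 ≈ Y 0 →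
                    ∀ m → X m ≈ Y m
  solution-unique {X} {Y} recX recY X₀≈Y₀ = <-rec (λ m → X m ≈ Y m) step
    where
    step : ∀ m → (∀ {j} → j < m → X j ≈ Y j) → X m ≈ Y m
    step zero    _  = X₀≈Y₀
    step (suc m) ih = begin
      X (suc m)                     ≈⟨ recX m ⟩
      sumBelow (suc m) (convolve X) ≈⟨ sumBelow-cong (suc m) (convolve X) (convolve Y) earlier ⟩
      sumBelow (suc m) (convolve Y) ≈⟨ recY m ⟨
      Y (suc m)                     ∎
      where
      convolve : (ℕ → Carrier) → ℕ → Carrier
      convolve Z j = coeff j * Z (m ∸ j)
      earlier : ∀ j → j < suc m → convolve X j ≈ convolve Y j
      earlier j _ = *-congˡ (ih (s≤s (m∸n≤m m j)))

module Fibonacci {a ℓ : Level} (R : CommutativeRing a ℓ)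
  (k : ℕ) (t : Fin k → CommutativeRing.Carrier R) where
  open CommutativeRing R hiding (zero)
  open FibDet R using (sumFin; index; FibList; Fib)
  open Sums R
  open SetoidReasoning setoid

  -- coeff j is t_{j+1}, extended by zero beyond k
  coeff : ℕ → Carrier
  coeff j with j <? k
  ... | yes j<k = t (fromℕ< j<k)
  ... | no _    = 0#

  coeff-< : ∀ j (j<k : j < k) → coeff j ≡ t (fromℕ< j<k)
  coeff-< j j<k with j <? k
  ... | yes j<k′ = ≡.cong t (fromℕ<-cong j j ≡.refl j<k′ j<k)
  ... | no  j≮k  = contradiction j<k j≮k

  coeff-≥ : ∀ j → ¬ j < k → coeff j ≡ 0#
  coeff-≥ j j≮k with j <? k
  ... | yes j<k = contradiction j<k j≮k
  ... | no  _   = ≡.refl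

  coeff-toℕ : ∀ x → coeff (toℕ x) ≡ t x
  coeff-toℕ x = ≡.trans (coeff-< (toℕ x) (toℕ<n x)) (≡.cong t (fromℕ<-toℕ x (toℕ<n x)))

  index-FibList : ∀ n j → j ≤ n → index (FibList k t n) j ≡ Fib k t (n ∸ j)
  index-FibList n                zero    _         = ≡.refl
  index-FibList (suc zero)       (suc zero) _      = ≡.refl
  index-FibList (suc zero)       (suc (suc j)) (s≤s ())
  index-FibList (suc (suc n))    (suc j) (s≤s j≤n) = index-FibList (suc n) j j≤n

  index-FibList-beyond : ∀ n j → n ≤ j → index (FibList k t n) j ≡ 0#
  index-FibList-beyond zero          zero    _         = ≡.refl
  index-FibList-beyond zero          (suc j) _         = ≡.refl
  index-FibList-beyond (suc zero)    (suc zero) _      = ≡.refl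
  index-FibList-beyond (suc zero)    (suc (suc j)) _   = ≡.refl
  index-FibList-beyond (suc (suc n)) (suc j) (s≤s n≤j) = index-FibList-beyond (suc n) j n≤j

  Fib-recurrence : ∀ m →
    Fib k t (suc (suc m)) ≈ sumBelow (suc m) (λ j → coeff j * Fib k t (suc (m ∸ j)))
  Fib-recurrence m = begin
    sumFin k (λ x → t x * index previous (toℕ x))
      ≈⟨ sumFin-cong k _ _ (λ x → *-congʳ (reflexive (≡.sym (coeff-toℕ x)))) ⟩
    sumBelow k term
      ≈⟨ sumBelow-support k (suc m) term term-beyond-k term-beyond-m ⟩
    sumBelow (suc m) term
      ≈⟨ sumBelow-cong (suc m) term (λ j → coeff j * Fib k t (suc (m ∸ j)))
           (λ j j≤m → *-congˡ (reflexive (index-previous j (s≤s⁻¹ j≤m)))) ⟩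
    sumBelow (suc m) (λ j → coeff j * Fib k t (suc (m ∸ j))) ∎
    where
    previous = FibList k t (suc m)
    term : ℕ → Carrier
    term j = coeff j * index previous j
    term-beyond-k : ∀ j → k ≤ j → term j ≈ 0#
    term-beyond-k j k≤j = trans (*-congʳ (reflexive (coeff-≥ j (≤⇒≯ k≤j)))) (zeroˡ _)
    term-beyond-m : ∀ j → suc m ≤ j → term j ≈ 0#
    term-beyond-m j m<j = trans (*-congˡ (reflexive (index-FibList-beyond (suc m) j m<j))) (zeroʳ _)
    index-previous : ∀ j → j ≤ m → index previous j ≡ Fib k t (suc (m ∸ j))
    index-previous j j≤m =
      ≡.trans (index-FibList (suc m) j (m≤n⇒m≤1+n j≤m))
              (≡.cong (Fib k t) (+-∸-assoc 1 j≤m))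

module FibonacciDeterminant {a ℓ : Level} (R : CommutativeRing a ℓ)
  (k : ℕ) (t : Fin k → CommutativeRing.Carrier R) (i t₂ u : CommutativeRing.Carrier R) where
  open CommutativeRing R hiding (zero)
  open FibDet R using (pow; Q; Fib)
  open Fibonacci R k t
  open Powers R using (sign-scaling)
  open Sums R using (sumBelow-cong)
  open SetoidReasoning setoid

  sub : ℕ → Carrier
  sub d = pow i d * (coeff d * pow u d)

  open HessenbergToeplitz R (i * t₂) sub public
  open LinearRecurrence R coeff

  Q≈H : ∀ n (r s : Fin n) → Q k t i t₂ u n r s ≈ H n r s
  Q≈H n r s with suc (toℕ r) ≟ toℕ s
  ... | yes 1+r≡s = reflexive (≡.sym (entry-super _ _ 1+r≡s))
  ... | no 1+r≢s with toℕ s ≤? toℕ r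
  ...   | no s≰r = reflexive (≡.sym (entry-above _ _ 1+r≢s s≰r))
  ...   | yes s≤r with toℕ r ∸ toℕ s <? k
  ...     | yes d<k = reflexive (≡.sym (≡.trans (entry-below _ _ s≤r)
                        (≡.cong (λ c → pow i d * (c * pow u d)) (coeff-< d d<k))))
    where d = toℕ r ∸ toℕ s
  ...     | no d≮k = sym (begin
    entry (toℕ r) (toℕ s)         ≡⟨ entry-below _ _ s≤r ⟩
    pow i d * (coeff d * pow u d) ≡⟨ ≡.cong (λ c → pow i d * (c * pow u d)) (coeff-≥ d d≮k) ⟩
    pow i d * (0# * pow u d)      ≈⟨ *-congˡ (zeroˡ _) ⟩
    pow i d * 0#                  ≈⟨ zeroʳ _ ⟩
    0#                            ∎)
    where d = toℕ r ∸ toℕ s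

  D-satisfies : i * i ≈ - 1# → t₂ * u ≈ 1# → Satisfies D
  D-satisfies i²≈-1 t₂u≈1 m =
    trans (D-suc m) (sumBelow-cong (suc m) _ (λ j → coeff j * D (m ∸ j)) λ j _ →
      *-congʳ (sign-scaling i²≈-1 t₂u≈1 (coeff j) j))

  D≈Fib : i * i ≈ - 1# → t₂ * u ≈ 1# → ∀ m → D m ≈ Fib k t (suc m)
  D≈Fib i²≈-1 t₂u≈1 = solution-unique (D-satisfies i²≈-1 t₂u≈1) Fib-recurrence refl

theorem2p2 : {c ℓ : Level} (R : CommutativeRing c ℓ) →
    let open CommutativeRing R in
    let open FibDet R in
    (k : ℕ) (2≤k : 2 ≤ k) (n : ℕ) → 1 ≤ n →
    (t : Fin k → Carrier) (i u : Carrier) →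
    i * i ≈ - 1# →
    t (fromℕ< {1} 2≤k) * u ≈ 1# →
    det n (Q k t i (t (fromℕ< {1} 2≤k)) u n) ≈ Fib k t (suc n)
theorem2p2 R k 2≤k n _ t i u i²≈-1 t₂u≈1 =
  CommutativeRing.trans R (Determinants.det-cong R n _ (H n) (Q≈H n)) (D≈Fib i²≈-1 t₂u≈1 n)
  where open FibonacciDeterminant R k t i (t (fromℕ< {1} 2≤k)) u
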